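{- Let $g>1$ and let $\mathcal M_1$ be the Wiman map of type I of genus $g$. Then the pattern of a mirror of a reflection of $\mathcal M_1$ is either $(\mathbf{12})^1$ or $(\mathbf{0102})^1$.
   Context: The Wiman surface of type I of genus $g$ is the unique Riemann surface of genus $g$ admitting a conformal automorphism of order $4g+2$; it carries a regular map $\mathcal M_1$ (the Wiman map of type I) of type $\{4g+2,2g+1\}$, with one face and two vertices, orientation-preserving automorphism group $C_{4g+2}$ and full automorphism group the dihedral group $D_{4g+2}$. The geometric points of a map are its vertices ($\mathbf 0$), edge-centres ($\mathbf 1$) and face-centres ($\mathbf 2$). The pattern of a mirror (fixed curve of a reflection of the map) is the cyclic sequence of geometric points met along it, written $(\ell)^K$ meaning the minimal repeating word $\ell$ repeated $K$ times. -}

module Defs where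

open import Data.Nat using (ℕ; zero; suc; _+_; _*_; _∸_; _<_; _≤_; NonZero)
open import Data.Nat.DivMod using (_mod_; _%_)
open import Data.Fin using (Fin; toℕ) renaming (zero to f0; suc to fs)
open import Data.Bool using (Bool; true; false; not; if_then_else_; _xor_)
open import Data.Product using (Σ; _×_; _,_; proj₁; proj₂; ∃)
open import Data.Sum using (_⊎_)
open import Relation.Binary.PropositionalEquality using (_≡_; _≢_)
open import Relation.Nullary using (¬_)

-- Combinatorial maps given by flags and the three monodromy involutions
-- r 0, r 1, r 2 (r i changes the geometric point of type i of a flag:
-- 0 = vertex, 1 = edge-centre, 2 = face-centre).  A flag is a triangle
-- of the barycentric subdivision; its side of type i is the side
-- opposite its point of type i, shared with the flag  r i Φ.

module MapNotions (Flag : Set) (r : Fin 3 → Flag → Flag) where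

  record IsAutomorphism (f : Flag → Flag) : Set where
    field
      inv      : Flag → Flag
      inv-left : ∀ Φ → inv (f Φ) ≡ Φ
      inv-right : ∀ Φ → f (inv Φ) ≡ Φ
      commutes : ∀ i Φ → f (r i Φ) ≡ r i (f Φ)

  -- Geometric points: a point of type j is represented by (j , Φ);
  -- two flags represent the same point of type j iff they are linked
  -- by a chain of the monodromies r i with i ≢ j.
  data Reach (j : Fin 3) (Φ : Flag) : Flag → Set where
    here : Reach j Φ Φ
    step : ∀ {Ψ} i → i ≢ j → Reach j Φ Ψ → Reach j Φ (r i Ψ)

  Point : Set
  Point = Fin 3 × Flag

  type : Point → Fin 3
  type = proj₁

  Side : Set
  Side = Fin 3 × Flag

  _≈S_ : Side → Side → Set
  (i , Φ) ≈S (i′ , Ψ) = i ≡ i′ × (Ψ ≡ Φ ⊎ Ψ ≡ r i Φ)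

  Incident : Side → Point → Set
  Incident (i , Φ) (j , Ψ) = i ≢ j × Reach j Φ Ψ

  -- A side lies (pointwise) in the fixed set of f iff f swaps its two flags.
  FixedSide : (Flag → Flag) → Side → Set
  FixedSide f (i , Φ) = f Φ ≡ r i Φ

  -- Reflections of the map: automorphisms that are involutions whose
  -- fixed-point set is a (non-empty) union of curves, i.e. which fix
  -- pointwise some side of the barycentric subdivision.
  record IsReflection (f : Flag → Flag) : Set where
    field
      automorphism : IsAutomorphism f
      involution   : ∀ Φ → f (f Φ) ≡ Φ
      fixes-side   : ∃ λ (s : Side) → FixedSide f s

  -- A mirror of a reflection f, traversed as a closed walk
  --   p 0 , s 0 , p 1 , s 1 , … , p (L-1) , s (L-1) , p L = p 0
  -- of length L: s k is a side fixed by f joining the points p k and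
  -- p (k+1); the sides are pairwise distinct, and the walk contains every
  -- fixed side meeting one of its points (so it is a whole connected
  -- component of the fixed curve of f).  Sequences are indexed by ℕ and
  -- are L-periodic.
  record MirrorWalk (f : Flag → Flag) (L : ℕ) : Set where
    field
      p : ℕ → Point
      s : ℕ → Side
      L-pos      : 1 ≤ L
      p-periodic : ∀ k → p (k + L) ≡ p k
      s-periodic : ∀ k → s (k + L) ≡ s k
      s-fixed    : ∀ k → FixedSide f (s k)
      s-start    : ∀ k → Incident (s k) (p k)
      s-end      : ∀ k → Incident (s k) (p (suc k))
      ends-differ : ∀ k → type (p k) ≢ type (p (suc k))
      s-distinct : ∀ k l → k < l → l < L → ¬ (s k ≈S s l)
      complete   : ∀ (t : Side) → FixedSide f t → ∀ k → Incident t (p k) →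
                   ∃ λ m → t ≈S s m

  -- The pattern of a mirror walk is the cyclic sequence  type ∘ p  of
  -- length L.  It equals (w)^1 for a word w of length L (given as an
  -- L-periodic function) iff it is some cyclic rotation of w.
  HasPattern : ∀ {f L} → MirrorWalk f L → (ℕ → Fin 3) → Set
  HasPattern {f} {L} W w = ∃ λ c → ∀ k → type (MirrorWalk.p W k) ≡ w (k + c)

pat12 : ℕ → Fin 3
pat12 k with k % 2
... | 0 = fs f0
... | _ = fs (fs f0)

pat0102 : ℕ → Fin 3
pat0102 k with k % 4
... | 0 = f0
... | 1 = fs f0
... | 2 = f0
... | _ = fs (fs f0)

-- Its flags are the elements of the dihedral group D_n, n = 4g+2,
-- written ρ^k σ^b  (k : Fin n, b : Bool), with σ ρ σ = ρ⁻¹.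
-- The monodromy r i acts by right multiplication by R i, where
--   R 0 = ρ σ ,  R 1 = σ ,  R 2 = σ ρ^(2g) = ρ^(2g+2) σ ,
-- so R0 R1 = ρ (order 4g+2, the face), R1 R2 = ρ^(2g) (order 2g+1,
-- the vertices), R0 R2 = ρ^(2g+1) (order 2).  This is the unique
-- regular map of type {4g+2, 2g+1} with monodromy / automorphism group
-- D_(4g+2) (orientation-preserving part C_(4g+2)), one face, two vertices.

wn : ℕ → ℕ
wn g = suc (suc (4 * g))

WimanFlag : ℕ → Set
WimanFlag g = Fin (wn g) × Bool

-- right multiplication by ρ^m σ :  ρ^k σ^b · ρ^m σ = ρ^(k ± m) σ^(not b)
mulRσ : (g : ℕ) → ℕ → WimanFlag g → WimanFlag g
mulRσ g m (k , false) = ((toℕ k + m) mod wn g) , true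
mulRσ g m (k , true)  = ((toℕ k + (wn g ∸ (m % wn g))) mod wn g) , false

wimanR : (g : ℕ) → Fin 3 → WimanFlag g → WimanFlag g
wimanR g f0           = mulRσ g 1
wimanR g (fs f0)      = mulRσ g 0
wimanR g (fs (fs _))  = mulRσ g (2 * g + 2)

-- Proposition 6.2: every mirror of a reflection of the Wiman map M₁ of
-- type I has pattern (12)^1 or (0102)^1.  (The argument works for all g.)
--
-- The flags of M₁ are the elements ρ^x σ^b of D_n, n = 4g+2 = 2h, and r i
-- is right multiplication by ρ^(M i) σ with M = (1, 0, 2g+2).  Automorphisms
-- commute with the r i, so a reflection (which fixes some side) is left
-- multiplication by some ρ^a σ, and it fixes the side of type i of ρ^x iff
-- a ≡ 2x + M i (mod n).  Three facts follow:
--   * 2x ≡ c (mod 2h) has two solutions, so at most two sides of each type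
--     are fixed;
--   * n is even, so for odd a all fixed sides have type 0, and for even a
--     none has;
--   * for even a, rotating about a vertex by ρ^(2g+2) carries a fixed side
--     of one non-zero type to a fixed side of the other.
-- For an arbitrary map, these three properties alone force every mirror
-- walk to have length 2 and pattern 12 (sides of type 0 only), or length 4
-- and pattern 0102 (vertices alternating with centres of both types).

module Submission where

open import Defs
open import Level using (0ℓ)
open import Data.Nat using (ℕ; zero; suc; _+_; _*_; _∸_; _<_; _≤_; NonZero; z<s; s<s)
open import Data.Nat.Properties
  using (+-comm; +-assoc; +-identityʳ; <-trans; n<1+n; <-≤-trans; ≰⇒>; *-cancelʳ-≡; m+[n∸m]≡n; m*n≢0)
open import Data.Nat.DivMod
open import Data.Nat.Divisibility using (_∣_; divides)
open import Data.Nat.Tactic.RingSolver using (solve-∀)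
open import Data.Bool using (Bool; true; false; not; _xor_)
open import Data.Bool.Properties using (not-involutive)
open import Data.Fin using (Fin; toℕ; _≟_)
open import Data.Fin.Patterns using (0F; 1F; 2F)
open import Data.Fin.Properties using (all?; toℕ-injective; toℕ-fromℕ<; toℕ<n)
open import Data.Product using (∃; _×_; _,_; proj₁; proj₂)
open import Data.Sum using (_⊎_; inj₁; inj₂; [_,_]; [_,_]′)
open import Data.Empty using (⊥; ⊥-elim)
open import Relation.Nullary using (Dec; yes; no; ¬?)
open import Relation.Nullary.Decidable using (toWitness; _→-dec_)
open import Relation.Binary.Bundles using (Setoid)
import Relation.Binary.Reasoning.Setoid as SetoidReasoning
open import Relation.Binary.PropositionalEquality
  using (_≡_; _≢_; refl; sym; trans; cong; subst; subst₂; ≢-sym; module ≡-Reasoning)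

third : ∀ {a b c d : Fin 3} → a ≢ b → c ≢ a → c ≢ b → d ≢ a → d ≢ b → c ≡ d
third {a} {b} {c} {d} = toWitness {a? = exhaustive} _ a b c d
  where
  exhaustive : Dec (∀ (a b c d : Fin 3) → a ≢ b → c ≢ a → c ≢ b → d ≢ a → d ≢ b → c ≡ d)
  exhaustive = all? λ a → all? λ b → all? λ c → all? λ d →
    ¬? (a ≟ b) →-dec ¬? (c ≟ a) →-dec ¬? (c ≟ b) →-dec
    ¬? (d ≟ a) →-dec ¬? (d ≟ b) →-dec (c ≟ d)

distinct-nonzero : ∀ {x y : Fin 3} → x ≢ 0F → y ≢ 0F → x ≢ y →
                   (x ≡ 1F × y ≡ 2F) ⊎ (x ≡ 2F × y ≡ 1F)
distinct-nonzero {0F} x≢0 _ _ = ⊥-elim (x≢0 refl)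
distinct-nonzero {_} {0F} _ y≢0 _ = ⊥-elim (y≢0 refl)
distinct-nonzero {1F} {1F} _ _ x≢y = ⊥-elim (x≢y refl)
distinct-nonzero {1F} {2F} _ _ _ = inj₁ (refl , refl)
distinct-nonzero {2F} {1F} _ _ _ = inj₂ (refl , refl)
distinct-nonzero {2F} {2F} _ _ x≢y = ⊥-elim (x≢y refl)

nonzero-pigeonhole : ∀ {a b c : Fin 3} → a ≢ 0F → b ≢ 0F → c ≢ 0F → a ≡ b ⊎ a ≡ c ⊎ b ≡ c
nonzero-pigeonhole {a} {b} {c} a≢0 b≢0 c≢0 with a ≟ b | a ≟ c
... | yes a≡b | _       = inj₁ a≡b
... | no _    | yes a≡c = inj₂ (inj₁ a≡c)
... | no a≢b  | no a≢c  = inj₂ (inj₂ (third (≢-sym a≢0) b≢0 (≢-sym a≢b) c≢0 (≢-sym a≢c)))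

periodic-agree : ∀ {A : Set} (P : ℕ) .{{_ : NonZero P}} (u v : ℕ → A) →
                 (∀ k → u (P + k) ≡ u k) → (∀ k → v (P + k) ≡ v k) →
                 (∀ k → k < P → u k ≡ v k) → ∀ k → u k ≡ v k
periodic-agree {A} P u v u-period v-period window k = begin
  u k                    ≡⟨ cong u (decompose k) ⟩
  u (k / P * P + k % P)  ≡⟨ shift u u-period (k / P) (k % P) ⟩
  u (k % P)              ≡⟨ window (k % P) (m%n<n k P) ⟩
  v (k % P)              ≡⟨ shift v v-period (k / P) (k % P) ⟨
  v (k / P * P + k % P)  ≡⟨ cong v (decompose k) ⟨
  v k                    ∎
  where
  open ≡-Reasoning
  decompose : ∀ k → k ≡ k / P * P + k % P
  decompose k = trans (m≡m%n+[m/n]*n k P) (+-comm (k % P) (k / P * P))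
  shift : ∀ (w : ℕ → A) → (∀ k → w (P + k) ≡ w k) → ∀ q r → w (q * P + r) ≡ w r
  shift w period zero r = refl
  shift w period (suc q) r =
    trans (cong w (+-assoc P (q * P) r)) (trans (period (q * P + r)) (shift w period q r))

window₂ : ∀ {A : Set} {u v : ℕ → A} → u 0 ≡ v 0 → u 1 ≡ v 1 → ∀ k → k < 2 → u k ≡ v k
window₂ e₀ e₁ 0 _ = e₀
window₂ e₀ e₁ 1 _ = e₁
window₂ e₀ e₁ (suc (suc k)) (s<s (s<s ()))

window₄ : ∀ {A : Set} {u v : ℕ → A} → u 0 ≡ v 0 → u 1 ≡ v 1 → u 2 ≡ v 2 → u 3 ≡ v 3 →
          ∀ k → k < 4 → u k ≡ v k
window₄ e₀ e₁ e₂ e₃ 0 _ = e₀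
window₄ e₀ e₁ e₂ e₃ 1 _ = e₁
window₄ e₀ e₁ e₂ e₃ 2 _ = e₂
window₄ e₀ e₁ e₂ e₃ 3 _ = e₃
window₄ e₀ e₁ e₂ e₃ (suc (suc (suc (suc k)))) (s<s (s<s (s<s (s<s ()))))

parity-cases : ∀ m → m % 2 ≡ 0 ⊎ m % 2 ≡ 1
parity-cases m with m % 2 | m%n<n m 2
... | 0           | _ = inj₁ refl
... | 1           | _ = inj₂ refl
... | suc (suc _) | s<s (s<s ())

length-two : ∀ {m} → 1 ≤ m → m ≢ 1 → m < 3 → m ≡ 2
length-two {1} _ m≢1 _ = ⊥-elim (m≢1 refl)
length-two {2} _ _ _ = refl
length-two {suc (suc (suc _))} _ _ (s<s (s<s (s<s ())))

length-four : ∀ {m} → 1 ≤ m → m ≢ 1 → m ≢ 2 → m ≢ 3 → m < 5 → m ≡ 4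
length-four {1} _ m≢1 _ _ _ = ⊥-elim (m≢1 refl)
length-four {2} _ _ m≢2 _ _ = ⊥-elim (m≢2 refl)
length-four {3} _ _ _ m≢3 _ = ⊥-elim (m≢3 refl)
length-four {4} _ _ _ _ _ = refl
length-four {suc (suc (suc (suc (suc _))))} _ _ _ _ (s<s (s<s (s<s (s<s (s<s ())))))

-- Combinatorics of mirrors in an arbitrary map (flags with monodromies r).
module Mirrors {Flag : Set} (r : Fin 3 → Flag → Flag) where
  open MapNotions Flag r

  reach-trans : ∀ {j Φ Ψ Θ} → Reach j Φ Ψ → Reach j Ψ Θ → Reach j Φ Θ
  reach-trans R here = R
  reach-trans R (step i i≢j R′) = step i i≢j (reach-trans R R′)

  reach-sym : (∀ i Φ → r i (r i Φ) ≡ Φ) → ∀ {j Φ Ψ} → Reach j Φ Ψ → Reach j Ψ Φ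
  reach-sym invol here = here
  reach-sym invol {j} (step {Ψ} i i≢j R) = reach-trans back (reach-sym invol R)
    where
    back : Reach j (r i Ψ) Ψ
    back = subst (Reach j (r i Ψ)) (invol i Ψ) (step i i≢j here)

  same-side : (∀ i Φ → r i (r i Φ) ≡ Φ) → ∀ {i A Φ Ψ} →
              Φ ≡ A ⊎ Φ ≡ r i A → Ψ ≡ A ⊎ Ψ ≡ r i A → (i , Φ) ≈S (i , Ψ)
  same-side invol (inj₁ refl) (inj₁ refl) = refl , inj₁ refl
  same-side invol (inj₁ refl) (inj₂ refl) = refl , inj₂ refl
  same-side invol {i} {A} (inj₂ refl) (inj₁ refl) = refl , inj₂ (sym (invol i A))
  same-side invol (inj₂ refl) (inj₂ refl) = refl , inj₁ refl

  fixed-across : (∀ i Φ → r i (r i Φ) ≡ Φ) → ∀ {f} → IsAutomorphism f →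
                 ∀ {i Φ} → FixedSide f (i , r i Φ) → FixedSide f (i , Φ)
  fixed-across invol {f} aut {i} {Φ} e = begin
    f Φ                ≡⟨ cong f (sym (invol i Φ)) ⟩
    f (r i (r i Φ))    ≡⟨ IsAutomorphism.commutes aut i (r i Φ) ⟩
    r i (f (r i Φ))    ≡⟨ cong (r i) e ⟩
    r i (r i (r i Φ))  ≡⟨ invol i (r i Φ) ⟩
    r i Φ              ∎
    where open ≡-Reasoning

  TwoPerType : (Flag → Flag) → Set
  TwoPerType f = ∀ {x y z : Side} → FixedSide f x → FixedSide f y → FixedSide f z →
                 proj₁ x ≡ proj₁ y → proj₁ y ≡ proj₁ z → x ≈S y ⊎ x ≈S z ⊎ y ≈S z

  BothTypesAtVertices : (Flag → Flag) → Set
  BothTypesAtVertices f = ∀ i Φ → i ≢ 0F → FixedSide f (i , Φ) →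
    ∃ λ (y : Side) → FixedSide f y × proj₁ y ≢ 0F × proj₁ y ≢ i × Reach 0F (proj₂ y) Φ

  AllFixedSidesOfType0 : (Flag → Flag) → Set
  AllFixedSidesOfType0 f = ∀ i Φ → FixedSide f (i , Φ) → i ≡ 0F

  NoFixedSideOfType0 : (Flag → Flag) → Set
  NoFixedSideOfType0 f = ∀ i Φ → FixedSide f (i , Φ) → i ≢ 0F

  module Walk {f : Flag → Flag} {L : ℕ} (W : MirrorWalk f L) where
    open MirrorWalk W

    τ : ℕ → Fin 3
    τ k = type (p k)

    σ : ℕ → Fin 3
    σ k = proj₁ (s k)

    σ≢start : ∀ k → σ k ≢ τ k
    σ≢start k = proj₁ (s-start k)

    σ≢end : ∀ k → σ k ≢ τ (suc k)
    σ≢end k = proj₁ (s-end k)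

    τ-period : ∀ {P} → L ≡ P → ∀ k → τ (P + k) ≡ τ k
    τ-period refl k = trans (cong τ (+-comm L k)) (cong proj₁ (p-periodic k))

    -- Consecutive points have different types, so the walk is not a loop.
    L≢1 : L ≢ 1
    L≢1 L≡1 = ends-differ 0 (sym (τ-period L≡1 0))

    -- The sides of the walk are distinct, so no three of them share a type
    -- when f fixes at most two sides per type.
    no-three : TwoPerType f → ∀ {k l m} → k < l → l < m → m < L → σ k ≡ σ l → σ l ≡ σ m → ⊥
    no-three two {k} {l} {m} k<l l<m m<L e₁ e₂
      with two (s-fixed k) (s-fixed l) (s-fixed m) e₁ e₂
    ... | inj₁ kl        = s-distinct k l k<l (<-trans l<m m<L) kl
    ... | inj₂ (inj₁ km) = s-distinct k m (<-trans k<l l<m) m<L km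
    ... | inj₂ (inj₂ lm) = s-distinct l m l<m m<L lm

    has-pattern : ∀ P .{{_ : NonZero P}} (w : ℕ → Fin 3) c → L ≡ P → (∀ k → w (P + k) ≡ w k) →
                  (∀ k → k < P → τ k ≡ w (k + c)) → HasPattern W w
    has-pattern P w c L≡P w-period window =
      c , periodic-agree P τ (λ k → w (k + c)) (τ-period L≡P)
            (λ k → trans (cong w (+-assoc P k c)) (w-period (k + c))) window

    ends-of-2-walk : L ≡ 2 → ∀ m →
                     (τ m ≡ τ 0 × τ (suc m) ≡ τ 1) ⊎ (τ m ≡ τ 1 × τ (suc m) ≡ τ 0)
    ends-of-2-walk L≡2 zero = inj₁ (refl , refl)
    ends-of-2-walk L≡2 (suc m) with ends-of-2-walk L≡2 m
    ... | inj₁ (e₀ , e₁) = inj₂ (e₁ , trans (τ-period L≡2 m) e₀)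
    ... | inj₂ (e₁ , e₀) = inj₁ (e₀ , trans (τ-period L≡2 m) e₁)

    sides-of-2-walk : L ≡ 2 → ∀ m → σ m ≢ τ 0 × σ m ≢ τ 1
    sides-of-2-walk L≡2 m with ends-of-2-walk L≡2 m
    ... | inj₁ (e₀ , e₁) = (λ q → σ≢start m (trans q (sym e₀))) ,
                           (λ q → σ≢end m (trans q (sym e₁)))
    ... | inj₂ (e₁ , e₀) = (λ q → σ≢end m (trans q (sym e₀))) ,
                           (λ q → σ≢start m (trans q (sym e₁)))

    -- On a walk of length 2, every fixed side at one of its points has type
    -- σ 0: by completeness it is a side of the walk, so, like σ 0, it avoids
    -- the two distinct point types.
    fixed-side-on-2-walk : L ≡ 2 → ∀ y v → FixedSide f y → Incident y (p v) → proj₁ y ≡ σ 0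
    fixed-side-on-2-walk L≡2 y v y-fixed y-at-v =
      let m , y≡σm , _ = complete y y-fixed v y-at-v
          σm≢τ₀ , σm≢τ₁ = sides-of-2-walk L≡2 m
      in third (ends-differ 0)
               (λ e → σm≢τ₀ (trans (sym y≡σm) e)) (λ e → σm≢τ₁ (trans (sym y≡σm) e))
               (σ≢start 0) (σ≢end 0)

    mirror-12 : TwoPerType f → (∀ k → σ k ≡ 0F) → L ≡ 2 × HasPattern W pat12
    mirror-12 two σ≡0 = L≡2 , pattern-of (distinct-nonzero (τ≢0 0) (τ≢0 1) (ends-differ 0))
      where
      τ≢0 : ∀ k → τ k ≢ 0F
      τ≢0 k e = σ≢start k (trans (σ≡0 k) (sym e))
      L≡2 : L ≡ 2
      L≡2 = length-two L-pos L≢1 (≰⇒> λ 2<L →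
        no-three two {0} {1} {2} z<s (s<s z<s) 2<L
                 (trans (σ≡0 0) (sym (σ≡0 1))) (trans (σ≡0 1) (sym (σ≡0 2))))
      pattern-of : (τ 0 ≡ 1F × τ 1 ≡ 2F) ⊎ (τ 0 ≡ 2F × τ 1 ≡ 1F) → HasPattern W pat12
      pattern-of (inj₁ (e₀ , e₁)) = has-pattern 2 pat12 0 L≡2 (λ _ → refl) (window₂ e₀ e₁)
      pattern-of (inj₂ (e₀ , e₁)) = has-pattern 2 pat12 1 L≡2 (λ _ → refl) (window₂ e₀ e₁)

    module NonzeroSides (two : TwoPerType f) (σ≢0 : ∀ k → σ k ≢ 0F) where

      vertex-end : ∀ k → τ k ≡ 0F ⊎ τ (suc k) ≡ 0F
      vertex-end k with τ k ≟ 0F | τ (suc k) ≟ 0F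
      ... | yes v | _     = inj₁ v
      ... | no _  | yes v = inj₂ v
      ... | no c  | no c′ = ⊥-elim (ends-differ k
              (third (σ≢0 k) (≢-sym (σ≢start k)) c (≢-sym (σ≢end k)) c′))

      after-vertex : ∀ {k} → τ k ≡ 0F → τ (suc k) ≢ 0F
      after-vertex {k} v v′ = ends-differ k (trans v (sym v′))

      before-vertex : ∀ {k} → τ (suc k) ≡ 0F → τ k ≢ 0F
      before-vertex {k} v′ v = ends-differ k (trans v (sym v′))

      after-centre : ∀ {k} → τ k ≢ 0F → τ (suc k) ≡ 0F
      after-centre {k} c with vertex-end k
      ... | inj₁ v = ⊥-elim (c v)
      ... | inj₂ v = v

      same-type : ∀ {k l x} → x ≢ 0F → σ k ≢ x → σ l ≢ x → σ k ≡ σ l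
      same-type {k} {l} x≢0 k≢x l≢x = third (≢-sym x≢0) (σ≢0 k) k≢x (σ≢0 l) l≢x

      around-centre : ∀ k → τ (suc k) ≢ 0F → σ k ≡ σ (suc k)
      around-centre k c = same-type c (σ≢end k) (σ≢start (suc k))

      -- Alternation forbids odd length 3.
      L≢3 : L ≢ 3
      L≢3 L≡3 with τ 0 ≟ 0F
      ... | yes v = after-vertex {2} (after-centre (after-vertex v)) (trans (τ-period L≡3 0) v)
      ... | no c  = c (trans (sym (τ-period L≡3 0)) (after-centre {2} (after-vertex (after-centre c))))

      -- Five sides would contain two pairs sharing a centre and a fifth
      -- side; two of the three resulting types agree, giving three sides of
      -- one type.
      module FiveSides (4<L : 4 < L) where
        three : ∀ {k l m} → k < l → l < m → m < 5 → σ k ≡ σ l → σ l ≡ σ m → ⊥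
        three k<l l<m m<5 = no-three two k<l l<m (<-≤-trans m<5 4<L)

        vertex-at-1 : τ 1 ≡ 0F → ⊥
        vertex-at-1 v₁ = pigeon (nonzero-pigeonhole (σ≢0 0) (σ≢0 1) (σ≢0 3))
          where
          σ₁≡σ₂ : σ 1 ≡ σ 2
          σ₁≡σ₂ = around-centre 1 (after-vertex v₁)
          σ₃≡σ₄ : σ 3 ≡ σ 4
          σ₃≡σ₄ = around-centre 3 (after-vertex (after-centre (after-vertex v₁)))
          pigeon : σ 0 ≡ σ 1 ⊎ σ 0 ≡ σ 3 ⊎ σ 1 ≡ σ 3 → ⊥
          pigeon (inj₁ σ₀≡σ₁)        = three {0} {1} {2} z<s (s<s z<s) (s<s (s<s z<s)) σ₀≡σ₁ σ₁≡σ₂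
          pigeon (inj₂ (inj₁ σ₀≡σ₃)) = three {0} {3} {4} z<s (s<s (s<s (s<s z<s)))
                                         (s<s (s<s (s<s (s<s z<s)))) σ₀≡σ₃ σ₃≡σ₄
          pigeon (inj₂ (inj₂ σ₁≡σ₃)) = three {1} {2} {3} (s<s z<s) (s<s (s<s z<s))
                                         (s<s (s<s (s<s z<s))) σ₁≡σ₂ (trans (sym σ₁≡σ₂) σ₁≡σ₃)

        vertex-at-2 : τ 2 ≡ 0F → ⊥
        vertex-at-2 v₂ = pigeon (nonzero-pigeonhole (σ≢0 0) (σ≢0 2) (σ≢0 4))
          where
          σ₀≡σ₁ : σ 0 ≡ σ 1
          σ₀≡σ₁ = around-centre 0 (before-vertex v₂)
          σ₂≡σ₃ : σ 2 ≡ σ 3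
          σ₂≡σ₃ = around-centre 2 (after-vertex v₂)
          pigeon : σ 0 ≡ σ 2 ⊎ σ 0 ≡ σ 4 ⊎ σ 2 ≡ σ 4 → ⊥
          pigeon (inj₁ σ₀≡σ₂)        = three {0} {1} {2} z<s (s<s z<s) (s<s (s<s z<s))
                                         σ₀≡σ₁ (trans (sym σ₀≡σ₁) σ₀≡σ₂)
          pigeon (inj₂ (inj₁ σ₀≡σ₄)) = three {0} {1} {4} z<s (s<s z<s)
                                         (s<s (s<s (s<s (s<s z<s)))) σ₀≡σ₁ (trans (sym σ₀≡σ₁) σ₀≡σ₄)
          pigeon (inj₂ (inj₂ σ₂≡σ₄)) = three {2} {3} {4} (s<s (s<s z<s)) (s<s (s<s (s<s z<s)))
                                         (s<s (s<s (s<s (s<s z<s)))) σ₂≡σ₃ (trans (sym σ₂≡σ₃) σ₂≡σ₄)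

      L<5 : L < 5
      L<5 = ≰⇒> λ 4<L → [ FiveSides.vertex-at-1 4<L , FiveSides.vertex-at-2 4<L ] (vertex-end 1)

      -- A vertex on a walk of length 2 would carry a fixed side of the
      -- non-zero type other than σ 0.
      L≢2 : BothTypesAtVertices f → L ≢ 2
      L≢2 both L≡2 = [ vertex-at 0 (s-start 0) , vertex-at 1 (s-end 0) ]′ (vertex-end 0)
        where
        vertex-at : ∀ v → Incident (s 0) (p v) → τ v ≡ 0F → ⊥
        vertex-at v (_ , R) τv≡0 =
          let y , y-fixed , y≢0 , y≢σ₀ , R′ = both (σ 0) (proj₂ (s 0)) (σ≢0 0) (s-fixed 0)
              y≢τv : proj₁ y ≢ τ v
              y≢τv e = y≢0 (trans e τv≡0)
              y-at-v : Reach (τ v) (proj₂ y) (proj₂ (p v))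
              y-at-v = reach-trans (subst (λ j → Reach j (proj₂ y) (proj₂ (s 0))) (sym τv≡0) R′) R
          in y≢σ₀ (fixed-side-on-2-walk L≡2 y v y-fixed (y≢τv , y-at-v))

      -- The centres k+1 and k+3 on either side of the vertex k+2 differ:
      -- otherwise the three sides k, k+1, k+2 all avoid that centre type.
      centres-differ : ∀ k → 2 + k < L → τ (suc k) ≢ 0F → τ (suc k) ≢ τ (3 + k)
      centres-differ k 2+k<L c e = no-three two {k} {suc k} {2 + k} (n<1+n k) (n<1+n (suc k)) 2+k<L
        (around-centre k c) (same-type c (σ≢start (suc k)) (λ q → σ≢end (2 + k) (trans q e)))

      mirror-0102 : BothTypesAtVertices f → L ≡ 4 × HasPattern W pat0102
      mirror-0102 both = L≡4 , [ vertex-first , centre-first ] (vertex-end 0)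
        where
        L≡4 : L ≡ 4
        L≡4 = length-four L-pos L≢1 (L≢2 both) L≢3 L<5
        3<L : 3 < L
        3<L = subst (3 <_) (sym L≡4) (s<s (s<s (s<s z<s)))

        vertex-first : τ 0 ≡ 0F → HasPattern W pat0102
        vertex-first v₀ = choose (distinct-nonzero c₁ c₃ (centres-differ 0 (<-trans (n<1+n 2) 3<L) c₁))
          where
          c₁ : τ 1 ≢ 0F
          c₁ = after-vertex v₀
          v₂ : τ 2 ≡ 0F
          v₂ = after-centre c₁
          c₃ : τ 3 ≢ 0F
          c₃ = after-vertex v₂
          choose : (τ 1 ≡ 1F × τ 3 ≡ 2F) ⊎ (τ 1 ≡ 2F × τ 3 ≡ 1F) → HasPattern W pat0102
          choose (inj₁ (e₁ , e₃)) = has-pattern 4 pat0102 0 L≡4 (λ _ → refl) (window₄ v₀ e₁ v₂ e₃)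
          choose (inj₂ (e₁ , e₃)) = has-pattern 4 pat0102 2 L≡4 (λ _ → refl) (window₄ v₀ e₁ v₂ e₃)

        centre-first : τ 1 ≡ 0F → HasPattern W pat0102
        centre-first v₁ = choose (distinct-nonzero c₀ c₂ τ₀≢τ₂)
          where
          c₀ : τ 0 ≢ 0F
          c₀ = before-vertex v₁
          c₂ : τ 2 ≢ 0F
          c₂ = after-vertex v₁
          v₃ : τ 3 ≡ 0F
          v₃ = after-centre c₂
          τ₀≢τ₂ : τ 0 ≢ τ 2
          τ₀≢τ₂ e = centres-differ 1 3<L c₂ (trans (sym e) (sym (τ-period L≡4 0)))
          choose : (τ 0 ≡ 1F × τ 2 ≡ 2F) ⊎ (τ 0 ≡ 2F × τ 2 ≡ 1F) → HasPattern W pat0102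
          choose (inj₁ (e₀ , e₂)) = has-pattern 4 pat0102 1 L≡4 (λ _ → refl) (window₄ e₀ v₁ e₂ v₃)
          choose (inj₂ (e₀ , e₂)) = has-pattern 4 pat0102 3 L≡4 (λ _ → refl) (window₄ e₀ v₁ e₂ v₃)

  mirror-patterns : ∀ {f} → TwoPerType f →
                    AllFixedSidesOfType0 f ⊎ (NoFixedSideOfType0 f × BothTypesAtVertices f) →
                    ∀ {L} (W : MirrorWalk f L) →
                    (L ≡ 2 × HasPattern W pat12) ⊎ (L ≡ 4 × HasPattern W pat0102)
  mirror-patterns two (inj₁ type-0) W =
    inj₁ (Walk.mirror-12 W two λ k → type-0 _ _ (MirrorWalk.s-fixed W k))
  mirror-patterns two (inj₂ (type-≢0 , both)) W =
    inj₂ (Walk.NonzeroSides.mirror-0102 W two (λ k → type-≢0 _ _ (MirrorWalk.s-fixed W k)) both)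

module Congruence (n : ℕ) .{{_ : NonZero n}} where
  infix 4 _≋_
  record _≋_ (x y : ℕ) : Set where
    constructor mod-eq
    field same-residue : x % n ≡ y % n

  ≡⇒≋ : ∀ {x y} → x ≡ y → x ≋ y
  ≡⇒≋ refl = mod-eq refl

  ≋-sym : ∀ {x y} → x ≋ y → y ≋ x
  ≋-sym (mod-eq e) = mod-eq (sym e)

  ≋-trans : ∀ {x y z} → x ≋ y → y ≋ z → x ≋ z
  ≋-trans (mod-eq e) (mod-eq e′) = mod-eq (trans e e′)

  ≋-setoid : Setoid 0ℓ 0ℓ
  ≋-setoid = record
    { Carrier = ℕ ; _≈_ = _≋_
    ; isEquivalence = record { refl = mod-eq refl ; sym = ≋-sym ; trans = ≋-trans } }

  module ≋-Reasoning = SetoidReasoning ≋-setoid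

  %-absorbˡ : ∀ x m → (x % n + m) % n ≡ (x + m) % n
  %-absorbˡ x m = begin
    (x % n + m) % n          ≡⟨ %-distribˡ-+ (x % n) m n ⟩
    (x % n % n + m % n) % n  ≡⟨ cong (λ z → (z + m % n) % n) (m%n%n≡m%n x n) ⟩
    (x % n + m % n) % n      ≡⟨ %-distribˡ-+ x m n ⟨
    (x + m) % n              ∎
    where open ≡-Reasoning

  +-congʳ : ∀ {x y} z → x ≋ y → x + z ≋ y + z
  +-congʳ {x} {y} z (mod-eq e) = mod-eq (begin
    (x + z) % n      ≡⟨ %-absorbˡ x z ⟨
    (x % n + z) % n  ≡⟨ cong (λ w → (w + z) % n) e ⟩
    (y % n + z) % n  ≡⟨ %-absorbˡ y z ⟩
    (y + z) % n      ∎)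
    where open ≡-Reasoning

  +-congˡ : ∀ {x y} z → x ≋ y → z + x ≋ z + y
  +-congˡ {x} {y} z e = subst₂ _≋_ (+-comm x z) (+-comm y z) (+-congʳ z e)

  multiple : ∀ x k → x + k * n ≋ x
  multiple x k = mod-eq ([m+kn]%n≡m%n x k n)

  +n : ∀ x → x + n ≋ x
  +n x = mod-eq ([m+n]%n≡m%n x n)

  neg : ℕ → ℕ
  neg m = n ∸ m % n

  neg-inverse : ∀ x m → x + (m + neg m) ≋ x
  neg-inverse x m = ≋-trans (+-congˡ x m+neg≋n) (+n x)
    where
    m+neg≋n : m + neg m ≋ n
    m+neg≋n = mod-eq (begin
      (m + neg m) % n            ≡⟨ %-absorbˡ m (neg m) ⟨
      (m % n + (n ∸ m % n)) % n  ≡⟨ cong (_% n) (m+[n∸m]≡n (m%n≤n m n)) ⟩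
      n % n                      ∎)
      where open ≡-Reasoning

  +-neg : ∀ x m → x + m + neg m ≋ x
  +-neg x m = ≋-trans (≡⇒≋ (+-assoc x m (neg m))) (neg-inverse x m)

  neg-+ : ∀ x m → x + neg m + m ≋ x
  neg-+ x m = ≋-trans (≡⇒≋ (trans (+-assoc x (neg m) m) (cong (x +_) (+-comm (neg m) m)))) (neg-inverse x m)

  +-cancelʳ : ∀ {x y} m → x + m ≋ y + m → x ≋ y
  +-cancelʳ {x} {y} m e = ≋-trans (≋-sym (+-neg x m)) (≋-trans (+-congʳ (neg m) e) (+-neg y m))

  module Halves (h : ℕ) .{{_ : NonZero h}} (n≡2h : n ≡ h * 2) where
    instance
      2h≢0 : NonZero (h * 2)
      2h≢0 = m*n≢0 h 2

    split : ∀ x → x ≋ x % h ⊎ x ≋ x % h + h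
    split x = by-bit ((x / h) % 2) (m%n<n (x / h) 2) (≋-trans (≡⇒≋ decompose) (multiple _ ((x / h) / 2)))
      where
      regroup : ∀ r e q d → r + (e + q * 2) * d ≡ r + e * d + q * (d * 2)
      regroup = solve-∀
      decompose : x ≡ x % h + (x / h) % 2 * h + (x / h) / 2 * n
      decompose = begin
        x
          ≡⟨ m≡m%n+[m/n]*n x h ⟩
        x % h + (x / h) * h
          ≡⟨ cong (λ q → x % h + q * h) (m≡m%n+[m/n]*n (x / h) 2) ⟩
        x % h + ((x / h) % 2 + (x / h) / 2 * 2) * h
          ≡⟨ regroup (x % h) ((x / h) % 2) ((x / h) / 2) h ⟩
        x % h + (x / h) % 2 * h + (x / h) / 2 * (h * 2)
          ≡⟨ cong (λ m → x % h + (x / h) % 2 * h + (x / h) / 2 * m) n≡2h ⟨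
        x % h + (x / h) % 2 * h + (x / h) / 2 * n
          ∎
        where open ≡-Reasoning
      by-bit : ∀ e → e < 2 → x ≋ x % h + e * h → x ≋ x % h ⊎ x ≋ x % h + h
      by-bit 0 _ x≋ = inj₁ (≋-trans x≋ (≡⇒≋ (+-identityʳ (x % h))))
      by-bit 1 _ x≋ = inj₂ (≋-trans x≋ (≡⇒≋ (cong (x % h +_) (+-identityʳ h))))
      by-bit (suc (suc _)) (s<s (s<s ())) _

    halve : ∀ {x y} → x + x ≋ y + y → x % h ≡ y % h
    halve {x} {y} (mod-eq e) = *-cancelʳ-≡ (x % h) (y % h) 2 (trans (sym (double x)) (trans e (double y)))
      where
      z+z≡z*2 : ∀ z → z + z ≡ z * 2
      z+z≡z*2 = solve-∀
      double : ∀ z → (z + z) % n ≡ z % h * 2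
      double z = begin
        (z + z) % n      ≡⟨ cong (_% n) (z+z≡z*2 z) ⟩
        z * 2 % n        ≡⟨ %-congʳ n≡2h ⟩
        z * 2 % (h * 2)  ≡⟨ m%n*o≡m*o%[n*o] z h 2 ⟨
        z % h * 2        ∎
        where open ≡-Reasoning

    +h+h : ∀ x → x + h + h ≋ x
    +h+h x = ≋-trans (≡⇒≋ (trans (+-assoc x h h) (cong (x +_) h+h≡n))) (+n x)
      where
      h+h≡h*2 : ∀ h → h + h ≡ h * 2
      h+h≡h*2 = solve-∀
      h+h≡n : h + h ≡ n
      h+h≡n = trans (h+h≡h*2 h) (sym n≡2h)

    halves : ∀ {x y} → x + x ≋ y + y → x ≋ y ⊎ x ≋ y + h
    halves {x} {y} e with split x | split y
    ... | inj₁ x≋r | inj₁ y≋r = inj₁ (begin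
      x      ≈⟨ x≋r ⟩
      x % h  ≡⟨ halve e ⟩
      y % h  ≈⟨ y≋r ⟨
      y      ∎)
      where open ≋-Reasoning
    ... | inj₂ x≋r | inj₂ y≋r = inj₁ (begin
      x          ≈⟨ x≋r ⟩
      x % h + h  ≡⟨ cong (_+ h) (halve e) ⟩
      y % h + h  ≈⟨ y≋r ⟨
      y          ∎)
      where open ≋-Reasoning
    ... | inj₁ x≋r | inj₂ y≋r = inj₂ (begin
      x              ≈⟨ x≋r ⟩
      x % h          ≡⟨ halve e ⟩
      y % h          ≈⟨ +h+h (y % h) ⟨
      y % h + h + h  ≈⟨ +-congʳ h y≋r ⟨
      y + h          ∎)
      where open ≋-Reasoning
    ... | inj₂ x≋r | inj₁ y≋r = inj₂ (begin
      x          ≈⟨ x≋r ⟩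
      x % h + h  ≡⟨ cong (_+ h) (halve e) ⟩
      y % h + h  ≈⟨ +-congʳ h y≋r ⟨
      y + h      ∎)
      where open ≋-Reasoning

    three-roots : ∀ {x y z} → x + x ≋ y + y → x + x ≋ z + z → x ≋ y ⊎ x ≋ z ⊎ y ≋ z
    three-roots xy xz with halves xy | halves xz
    ... | inj₁ x≋y   | _          = inj₁ x≋y
    ... | inj₂ _     | inj₁ x≋z   = inj₂ (inj₁ x≋z)
    ... | inj₂ x≋y+h | inj₂ x≋z+h = inj₂ (inj₂ (+-cancelʳ h (≋-trans (≋-sym x≋y+h) x≋z+h)))

    parity : ∀ {x y} → x ≋ y → x % 2 ≡ y % 2
    parity {x} {y} (mod-eq e) =
      trans (sym (m∣n⇒o%n%m≡o%m 2 n x 2∣n)) (trans (cong (_% 2) e) (m∣n⇒o%n%m≡o%m 2 n y 2∣n))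
      where
      2∣n : 2 ∣ n
      2∣n = divides h n≡2h

-- The Wiman map of type I of genus g and the fixed sides of its reflections.
module WimanMap (g : ℕ) where
  n : ℕ
  n = wn g

  h : ℕ
  h = suc (2 * g)

  n≡2h : n ≡ h * 2
  n≡2h = identity g
    where
    identity : ∀ g → suc (suc (4 * g)) ≡ suc (2 * g) * 2
    identity = solve-∀

  open Congruence n
  open Halves h n≡2h

  Flag : Set
  Flag = WimanFlag g

  r : Fin 3 → Flag → Flag
  r = wimanR g

  open MapNotions Flag r
  open Mirrors r

  -- F x b is the flag ρ^x σ^b, the exponent x read modulo n.
  F : ℕ → Bool → Flag
  F x b = x mod n , b

  toℕ-mod : ∀ x → toℕ (x mod n) ≡ x % n
  toℕ-mod x = toℕ-fromℕ< (m%n<n x n)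

  reduce : ∀ x → toℕ (x mod n) ≋ x
  reduce x = mod-eq (trans (cong (_% n) (toℕ-mod x)) (m%n%n≡m%n x n))

  F-cong : ∀ {x y} b → x ≋ y → F x b ≡ F y b
  F-cong {x} {y} b (mod-eq e) =
    cong (_, b) (toℕ-injective (trans (toℕ-mod x) (trans e (sym (toℕ-mod y)))))

  F-inj : ∀ {x y b b′} → F x b ≡ F y b′ → x ≋ y
  F-inj {x} {y} e =
    ≋-trans (≋-sym (reduce x)) (≋-trans (≡⇒≋ (cong (λ Φ → toℕ (proj₁ Φ)) e)) (reduce y))

  F-toℕ : ∀ k b → F (toℕ k) b ≡ (k , b)
  F-toℕ k b = cong (_, b) (toℕ-injective (trans (toℕ-mod (toℕ k)) (m<n⇒m%n≡m (toℕ<n k))))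

  -- r i is right multiplication by ρ^(M i) σ.
  M : Fin 3 → ℕ
  M 0F = 1
  M 1F = 0
  M 2F = 2 * g + 2

  r≡mul : ∀ i Φ → r i Φ ≡ mulRσ g (M i) Φ
  r≡mul 0F Φ = refl
  r≡mul 1F Φ = refl
  r≡mul 2F Φ = refl

  r-false : ∀ i x → r i (F x false) ≡ F (x + M i) true
  r-false i x = trans (r≡mul i _) (F-cong true (+-congʳ (M i) (reduce x)))

  r-true : ∀ i x → r i (F x true) ≡ F (x + neg (M i)) false
  r-true i x = trans (r≡mul i _) (F-cong false (+-congʳ (neg (M i)) (reduce x)))

  r-colour : ∀ i Φ → proj₂ (r i Φ) ≡ not (proj₂ Φ)
  r-colour i (k , false) = cong proj₂ (r≡mul i (k , false))
  r-colour i (k , true)  = cong proj₂ (r≡mul i (k , true))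

  r-involutive : ∀ i Φ → r i (r i Φ) ≡ Φ
  r-involutive i (k , false) = begin
    r i (r i (k , false))                ≡⟨ cong (λ Φ → r i (r i Φ)) (F-toℕ k false) ⟨
    r i (r i (F (toℕ k) false))          ≡⟨ cong (r i) (r-false i (toℕ k)) ⟩
    r i (F (toℕ k + M i) true)           ≡⟨ r-true i (toℕ k + M i) ⟩
    F (toℕ k + M i + neg (M i)) false    ≡⟨ F-cong false (+-neg (toℕ k) (M i)) ⟩
    F (toℕ k) false                      ≡⟨ F-toℕ k false ⟩
    (k , false)                          ∎
    where open ≡-Reasoning
  r-involutive i (k , true) = begin
    r i (r i (k , true))                 ≡⟨ cong (λ Φ → r i (r i Φ)) (F-toℕ k true) ⟨
    r i (r i (F (toℕ k) true))           ≡⟨ cong (r i) (r-true i (toℕ k)) ⟩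
    r i (F (toℕ k + neg (M i)) false)    ≡⟨ r-false i (toℕ k + neg (M i)) ⟩
    F (toℕ k + neg (M i) + M i) true     ≡⟨ F-cong true (neg-+ (toℕ k) (M i)) ⟩
    F (toℕ k) true                       ≡⟨ F-toℕ k true ⟩
    (k , true)                           ∎
    where open ≡-Reasoning

  face-rotation : ∀ x → r 1F (r 0F (F x false)) ≡ F (suc x) false
  face-rotation x = trans (cong (r 1F) (r-false 0F x))
                          (trans (r-true 1F (x + 1)) (F-cong false (≋-trans (+n (x + 1)) (≡⇒≋ (+-comm x 1)))))

  colour-swap : ∀ x → r 1F (F x false) ≡ F x true
  colour-swap x = trans (r-false 1F x) (cong (λ w → F w true) (+-identityʳ x))

  vertex-rotation : ∀ z → r 1F (r 2F (F z false)) ≡ F (z + (2 * g + 2)) false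
  vertex-rotation z = trans (cong (r 1F) (r-false 2F z))
                             (trans (r-true 1F (z + (2 * g + 2))) (F-cong false (+n (z + (2 * g + 2)))))

  around-vertex : ∀ k z → Reach 0F (F z false) (F (z + k * (2 * g + 2)) false)
  around-vertex zero z = subst (λ w → Reach 0F (F z false) (F w false)) (sym (+-identityʳ z)) here
  around-vertex (suc k) z =
    subst (Reach 0F (F z false))
          (trans (vertex-rotation (z + k * (2 * g + 2))) (cong (λ w → F w false) (regroup z k (2 * g + 2))))
          (step 1F (λ ()) (step 2F (λ ()) (around-vertex k z)))
    where
    regroup : ∀ z k m → z + k * m + m ≡ z + (m + k * m)
    regroup = solve-∀

  -- The exponent x of the flag F x false of a side (the other flag of the
  -- side (i , F x false) is r i (F x false)).
  base : Side → ℕ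
  base (i , (k , false)) = toℕ k
  base (i , (k , true))  = toℕ k + neg (M i)

  side-normal : ∀ i Φ → Φ ≡ F (base (i , Φ)) false ⊎ Φ ≡ r i (F (base (i , Φ)) false)
  side-normal i (k , false) = inj₁ (sym (F-toℕ k false))
  side-normal i (k , true)  = inj₂ (sym (begin
    r i (F (toℕ k + neg (M i)) false)  ≡⟨ r-false i (toℕ k + neg (M i)) ⟩
    F (toℕ k + neg (M i) + M i) true   ≡⟨ F-cong true (neg-+ (toℕ k) (M i)) ⟩
    F (toℕ k) true                     ≡⟨ F-toℕ k true ⟩
    (k , true)                         ∎))
    where open ≡-Reasoning

  same-base : ∀ {i Φ Ψ} → base (i , Φ) ≋ base (i , Ψ) → (i , Φ) ≈S (i , Ψ)
  same-base {i} {Φ} {Ψ} e = same-side r-involutive (side-normal i Φ)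
    (subst (λ A → Ψ ≡ A ⊎ Ψ ≡ r i A) (F-cong false (≋-sym e)) (side-normal i Ψ))

  side-at-vertex : ∀ {i} Φ → i ≢ 0F → Reach 0F (F (base (i , Φ)) false) Φ
  side-at-vertex {i} Φ i≢0 with side-normal i Φ
  ... | inj₁ Φ≡A = subst (Reach 0F _) (sym Φ≡A) here
  ... | inj₂ Φ≡rA = subst (Reach 0F _) (sym Φ≡rA) (step i i≢0 here)

  -- Automorphisms commute with the monodromies, hence with the rotation ρ;
  -- so f either preserves (rotations) or reverses (reflections) the
  -- colour b of all flags ρ^x σ^b alike.
  module Automorphism {f : Flag → Flag} (aut : IsAutomorphism f) where
    open IsAutomorphism aut

    β : Bool
    β = proj₂ (f (F 0 false))

    f-rotation : ∀ x → f (F (suc x) false) ≡ r 1F (r 0F (f (F x false)))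
    f-rotation x = begin
      f (F (suc x) false)               ≡⟨ cong f (face-rotation x) ⟨
      f (r 1F (r 0F (F x false)))       ≡⟨ commutes 1F _ ⟩
      r 1F (f (r 0F (F x false)))       ≡⟨ cong (r 1F) (commutes 0F _) ⟩
      r 1F (r 0F (f (F x false)))       ∎
      where open ≡-Reasoning

    colour-false : ∀ x → proj₂ (f (F x false)) ≡ β
    colour-false zero = refl
    colour-false (suc x) = begin
      proj₂ (f (F (suc x) false))             ≡⟨ cong proj₂ (f-rotation x) ⟩
      proj₂ (r 1F (r 0F (f (F x false))))     ≡⟨ r-colour 1F _ ⟩
      not (proj₂ (r 0F (f (F x false))))      ≡⟨ cong not (r-colour 0F _) ⟩
      not (not (proj₂ (f (F x false))))       ≡⟨ not-involutive _ ⟩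
      proj₂ (f (F x false))                   ≡⟨ colour-false x ⟩
      β                                       ∎
      where open ≡-Reasoning

    colour : ∀ Φ → proj₂ (f Φ) ≡ proj₂ Φ xor β
    colour (k , false) = trans (cong (λ Φ → proj₂ (f Φ)) (sym (F-toℕ k false))) (colour-false (toℕ k))
    colour (k , true) = begin
      proj₂ (f (k , true))
        ≡⟨ cong (λ Φ → proj₂ (f Φ)) (trans (colour-swap (toℕ k)) (F-toℕ k true)) ⟨
      proj₂ (f (r 1F (F (toℕ k) false)))      ≡⟨ cong proj₂ (commutes 1F _) ⟩
      proj₂ (r 1F (f (F (toℕ k) false)))      ≡⟨ r-colour 1F _ ⟩
      not (proj₂ (f (F (toℕ k) false)))       ≡⟨ cong not (colour-false (toℕ k)) ⟩
      not β                                   ∎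
      where open ≡-Reasoning

    -- A reflection fixes a side, so it reverses colours.
    fixes-side⇒reversing : ∀ y → FixedSide f y → β ≡ true
    fixes-side⇒reversing (i , Φ) e =
      xor-not (proj₂ Φ) β (trans (sym (colour Φ)) (trans (cong proj₂ e) (r-colour i Φ)))
      where
      xor-not : ∀ b c → b xor c ≡ not b → c ≡ true
      xor-not false true  _ = refl
      xor-not false false ()
      xor-not true  true  _ = refl
      xor-not true  false ()

    -- A colour-reversing f is left multiplication by ρ^a σ.
    module Reversing (β≡true : β ≡ true) where
      a : ℕ
      a = toℕ (proj₁ (f (F 0 false)))

      -- ρ^x ↦ ρ^(a - x) σ, where -x is represented by x (n - 1) = x · neg 1.
      image : ∀ x → f (F x false) ≡ F (a + x * neg 1) true
      image zero = begin
        f (F 0 false)                   ≡⟨ cong (proj₁ (f (F 0 false)) ,_) β≡true ⟩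
        (proj₁ (f (F 0 false)) , true)  ≡⟨ F-toℕ _ true ⟨
        F a true                        ≡⟨ cong (λ w → F w true) (+-identityʳ a) ⟨
        F (a + 0 * neg 1) true          ∎
        where open ≡-Reasoning
      image (suc x) = begin
        f (F (suc x) false)                     ≡⟨ f-rotation x ⟩
        r 1F (r 0F (f (F x false)))             ≡⟨ cong (λ Φ → r 1F (r 0F Φ)) (image x) ⟩
        r 1F (r 0F (F (a + x * neg 1) true))    ≡⟨ cong (r 1F) (r-true 0F (a + x * neg 1)) ⟩
        r 1F (F (a + x * neg 1 + neg 1) false)  ≡⟨ r-false 1F (a + x * neg 1 + neg 1) ⟩
        F (a + x * neg 1 + neg 1 + 0) true      ≡⟨ cong (λ w → F w true) (regroup a x (neg 1)) ⟩
        F (a + suc x * neg 1) true              ∎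
        where
        open ≡-Reasoning
        regroup : ∀ a x c → a + x * c + c + 0 ≡ a + (c + x * c)
        regroup = solve-∀

      fixed⇒ : ∀ {i x} → FixedSide f (i , F x false) → a ≋ x + x + M i
      fixed⇒ {i} {x} e = begin
        a                  ≈⟨ multiple a x ⟨
        a + x * n          ≡⟨ regroup a x (neg 1) ⟨
        a + x * neg 1 + x  ≈⟨ +-congʳ x (F-inj (trans (sym (image x)) (trans e (r-false i x)))) ⟩
        x + M i + x        ≡⟨ swap x (M i) ⟩
        x + x + M i        ∎
        where
        open ≋-Reasoning
        regroup : ∀ a x c → a + x * c + x ≡ a + x * suc c
        regroup = solve-∀
        swap : ∀ x m → x + m + x ≡ x + x + m
        swap = solve-∀

      ⇒fixed : ∀ {i x} → a ≋ x + x + M i → FixedSide f (i , F x false)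
      ⇒fixed {i} {x} e = trans (image x) (trans (F-cong true a-x≋) (sym (r-false i x)))
        where
        regroup : ∀ x m c → x + x + m + x * c ≡ x + m + x * suc c
        regroup = solve-∀
        a-x≋ : a + x * neg 1 ≋ x + M i
        a-x≋ = begin
          a + x * neg 1            ≈⟨ +-congʳ (x * neg 1) e ⟩
          x + x + M i + x * neg 1  ≡⟨ regroup x (M i) (neg 1) ⟩
          x + M i + x * n          ≈⟨ multiple (x + M i) x ⟩
          x + M i                  ∎
          where open ≋-Reasoning

      fixed-base : ∀ {i Φ} → FixedSide f (i , Φ) → a ≋ base (i , Φ) + base (i , Φ) + M i
      fixed-base {i} {Φ} e with side-normal i Φ
      ... | inj₁ Φ≡A  = fixed⇒ {i} {base (i , Φ)} (subst (λ Ψ → FixedSide f (i , Ψ)) Φ≡A e)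
      ... | inj₂ Φ≡rA = fixed⇒ {i} {base (i , Φ)}
        (fixed-across r-involutive aut {i} {F (base (i , Φ)) false}
                      (subst (λ Ψ → FixedSide f (i , Ψ)) Φ≡rA e))

      same-double : ∀ {i Φ Ψ} → FixedSide f (i , Φ) → FixedSide f (i , Ψ) →
                    base (i , Φ) + base (i , Φ) ≋ base (i , Ψ) + base (i , Ψ)
      same-double {i} {Φ} {Ψ} eΦ eΨ =
        +-cancelʳ (M i) (≋-trans (≋-sym (fixed-base {i} {Φ} eΦ)) (fixed-base {i} {Ψ} eΨ))

      -- Since 2x ≡ c (mod 2h) has two solutions, f fixes two sides of each type.
      two-per-type : TwoPerType f
      two-per-type {i , Φ} {.i , Ψ} {.i , Θ} eΦ eΨ eΘ refl refl
        with three-roots (same-double {i} {Φ} {Ψ} eΦ eΨ) (same-double {i} {Φ} {Θ} eΦ eΘ)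
      ... | inj₁ ΦΨ        = inj₁ (same-base ΦΨ)
      ... | inj₂ (inj₁ ΦΘ) = inj₂ (inj₁ (same-base ΦΘ))
      ... | inj₂ (inj₂ ΨΘ) = inj₂ (inj₂ (same-base ΨΘ))

      fixed-parity : ∀ {i Φ} → FixedSide f (i , Φ) → a % 2 ≡ M i % 2
      fixed-parity {i} {Φ} e = trans (parity (fixed-base {i} {Φ} e)) (double-plus (base (i , Φ)) (M i))
        where
        rearrange : ∀ x m → x + x + m ≡ m + x * 2
        rearrange = solve-∀
        double-plus : ∀ x m → (x + x + m) % 2 ≡ m % 2
        double-plus x m = trans (cong (_% 2) (rearrange x m)) ([m+kn]%n≡m%n m x 2)

      M₂-even : M 2F % 2 ≡ 0
      M₂-even = trans (cong (_% 2) (rearrange g)) ([m+kn]%n≡m%n 0 (suc g) 2)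
        where
        rearrange : ∀ g → 2 * g + 2 ≡ 0 + suc g * 2
        rearrange = solve-∀

      odd⇒type-0 : a % 2 ≡ 1 → AllFixedSidesOfType0 f
      odd⇒type-0 odd 0F _ _ = refl
      odd⇒type-0 odd 1F Φ e with trans (sym odd) (fixed-parity {1F} {Φ} e)
      ... | ()
      odd⇒type-0 odd 2F Φ e with trans (sym odd) (trans (fixed-parity {2F} {Φ} e) M₂-even)
      ... | ()

      even⇒type-≢0 : a % 2 ≡ 0 → NoFixedSideOfType0 f
      even⇒type-≢0 even 0F Φ e _ with trans (sym even) (fixed-parity {0F} {Φ} e)
      ... | ()

      vertex-partner : ∀ {i Φ} j k → i ≢ 0F → FixedSide f (i , Φ) →
        (∀ x → (x + k * (2 * g + 2)) + (x + k * (2 * g + 2)) + M j ≡ x + x + M i + suc g * n) →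
        ∃ λ y → FixedSide f (j , F y false) × Reach 0F (F y false) Φ
      vertex-partner {i} {Φ} j k i≢0 e solves =
        y , ⇒fixed {j} {y} (≋-trans (fixed-base {i} {Φ} e) (≋-sym y-root))
          , reach-trans (reach-sym r-involutive (around-vertex k x)) (side-at-vertex Φ i≢0)
        where
        x : ℕ
        x = base (i , Φ)
        y : ℕ
        y = x + k * (2 * g + 2)
        y-root : y + y + M j ≋ x + x + M i
        y-root = ≋-trans (≡⇒≋ (solves x)) (multiple (x + x + M i) (suc g))

      both-types : BothTypesAtVertices f
      both-types 0F _ i≢0 _ = ⊥-elim (i≢0 refl)
      both-types 1F Φ i≢0 e =
        let y , y-fixed , R = vertex-partner {1F} {Φ} 2F g i≢0 e (steps₁₂ g)
        in (2F , F y false) , y-fixed , (λ ()) , (λ ()) , R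
        where
        steps₁₂ : ∀ g x → (x + g * (2 * g + 2)) + (x + g * (2 * g + 2)) + (2 * g + 2)
                          ≡ x + x + 0 + suc g * suc (suc (4 * g))
        steps₁₂ = solve-∀
      both-types 2F Φ i≢0 e =
        let y , y-fixed , R = vertex-partner {2F} {Φ} 1F (suc g) i≢0 e (steps₂₁ g)
        in (1F , F y false) , y-fixed , (λ ()) , (λ ()) , R
        where
        steps₂₁ : ∀ g x → (x + suc g * (2 * g + 2)) + (x + suc g * (2 * g + 2)) + 0
                          ≡ x + x + (2 * g + 2) + suc g * suc (suc (4 * g))
        steps₂₁ = solve-∀

  reflection-structure : ∀ {f} → IsReflection f → TwoPerType f ×
    (AllFixedSidesOfType0 f ⊎ (NoFixedSideOfType0 f × BothTypesAtVertices f))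
  reflection-structure isR =
    two-per-type ,
    [ (λ even → inj₂ (even⇒type-≢0 even , both-types))
    , (λ odd → inj₁ (odd⇒type-0 odd)) ]′ (parity-cases a)
    where
    open IsReflection isR
    open Automorphism automorphism
    open Reversing (fixes-side⇒reversing (proj₁ fixes-side) (proj₂ fixes-side))

proposition6p2 : (g : ℕ) → 1 < g →
    let open MapNotions (WimanFlag g) (wimanR g) in
    (f : WimanFlag g → WimanFlag g) → IsReflection f →
    (L : ℕ) → (W : MirrorWalk f L) →
      (L ≡ 2 × HasPattern W pat12) ⊎ (L ≡ 4 × HasPattern W pat0102)
proposition6p2 g _ f isR L W =
  let two-per-type , kind = WimanMap.reflection-structure g isR
  in Mirrors.mirror-patterns (wimanR g) two-per-type kind W
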